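{- Let $T$ be the complete $k$-ary tree with $k \ge 2$ and depth $d \ge 1$ (the rooted tree in which every non-leaf vertex has exactly $k$ children and all leaves are at distance $d$ from the root). Let $m = d \bmod 3$ and $t = (d-1) \bmod 3$. Then $\textrm{RED:LD}(T) = k+1$ if $d=1$; $\textrm{RED:LD}(T) = k^2+k$ if $d=2$; $\textrm{RED:LD}(T) = k^3+k^2+2$ if $d=3$; and for $d \ge 4$, $$\textrm{RED:LD}(T) = (1-m)(2-m) + k^t(k+1)\frac{k^{3\lceil d/3\rceil}-1}{k^3-1}.$$
   Context: $N(v)$ denotes the open neighborhood of $v$. A set $S \subseteq V(G)$ is a locating-dominating (LD) set if for all $u,v \in V(G)-S$: $N(v)\cap S \neq \varnothing$, and if $u \ne v$ then $N(v) \cap S \neq N(u) \cap S$. A RED:LD set is an LD set $S$ such that $S-\{v\}$ is an LD set for every $v \in S$. $\textrm{RED:LD}(G)$ is the minimum cardinality of a RED:LD set of $G$. -}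

module Defs where

open import Data.Nat using (ℕ; zero; suc; _+_; _*_; _∸_; _^_; _≤_; _<_)
open import Data.Nat.DivMod using (_/_)
open import Data.Fin using (Fin)
open import Data.List using (List; []; _∷_; length)
open import Data.List.Membership.Propositional using (_∈_)
open import Data.List.Relation.Unary.All using (All)
open import Data.List.Relation.Unary.Unique.Propositional using (Unique)
open import Data.Product using (Σ; ∃; ∃-syntax; _×_)
open import Data.Sum using (_⊎_)
open import Relation.Nullary using (¬_)
open import Relation.Binary.PropositionalEquality using (_≡_; _≢_)
open import Function.Bundles using (_⇔_)

module _ {A : Set} (V : A → Set) (Adj : A → A → Set) where

  -- S is a locating-dominating set (S given by a membership predicate,
  -- assumed to consist of vertices).
  IsLD : (A → Set) → Set
  IsLD S = ∀ u v → V u → V v → ¬ S u → ¬ S v →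
             (∃[ w ] (S w × Adj v w))
           × (u ≢ v → ¬ (∀ w → S w → (Adj u w ⇔ Adj v w)))

  IsRedLD : (A → Set) → Set
  IsRedLD S = IsLD S × (∀ x → S x → IsLD (λ w → S w × w ≢ x))

  -- RED:LD(G) = n : n is the minimum cardinality of a RED:LD set.
  -- Finite vertex sets are duplicate-free lists of vertices.
  RedLDNumber : ℕ → Set
  RedLDNumber n =
      (∃[ S ] (Unique S × All V S × IsRedLD (_∈ S) × length S ≡ n))
    × (∀ (S : List A) → Unique S → All V S → IsRedLD (_∈ S) → n ≤ length S)

-- The complete k-ary tree of depth d.
-- A vertex is a word over Fin k of length ≤ d (the path from the root,
-- most recent step first); the root is [], the children of u are c ∷ u.

TreeV : (k d : ℕ) → List (Fin k) → Set
TreeV k d l = length l ≤ d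

TreeAdj : (k : ℕ) → List (Fin k) → List (Fin k) → Set
TreeAdj k u v = (∃[ c ] (v ≡ c ∷ u)) ⊎ (∃[ c ] (u ≡ c ∷ v))

RedLDTree : (k d n : ℕ) → Set
RedLDTree k d n = RedLDNumber (TreeV k d) (TreeAdj k) n

-- total division (m /' 0 = 0; only used with a nonzero divisor)
_/'_ : ℕ → ℕ → ℕ
m /' zero = 0
m /' suc n = m / suc n

ceil3 : ℕ → ℕ
ceil3 d = (d + 2) / 3

formula : ℕ → ℕ → ℕ
formula k d = (1 ∸ m) * (2 ∸ m)
              + (k ^ t) * (k + 1) * ((k ^ (3 * ceil3 d) ∸ 1) /' (k ^ 3 ∸ 1))
  where
  open import Data.Nat.DivMod using (_%_)
  m = d % 3
  t = (d ∸ 1) % 3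

{-# OPTIONS --safe #-}
-- If S is a RED:LD set, every vertex has at least two members of S in its closed
-- neighbourhood: a member of S is dominated by S without itself, and a non-member is dominated
-- both by S and by S without that dominator. In the complete k-ary tree, with heights counted
-- from the leaves, this local condition gives by induction on the height that every subtree
-- meets S in at least as many vertices as it has at heights ≢ 2 (mod 3), plus a surplus that
-- depends on the height mod 3 and on whether the root of the subtree and its parent lie in S;
-- at the root of the tree the surplus is 1 exactly when d ≡ 0 (mod 3).
--
-- Conversely, the vertices at heights ≢ 2 (mod 3), together with one child of the root when
-- d ≡ 0 (mod 3), form a RED:LD set: a vertex outside it has two children and (unless it is the
-- root) its parent inside. Two distinct vertices of a tree share at most one neighbour and two
-- adjacent ones share none, which separates the vertices outside the set even after deleting
-- one member (this can leave a single neighbour in the set only to the deleted vertex itself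
-- and to the root). Counting the set level by level gives a geometric series in k³, which sums
-- to the closed formula.
module Submission where

open import Defs
open import Data.Bool using (Bool; true; false; not; T; if_then_else_)
open import Data.Empty using (⊥; ⊥-elim)
open import Data.Fin using (Fin; zero; suc)
open import Data.Fin.Properties using () renaming (_≟_ to _≟ᶠ_)
open import Data.List using (List; []; _∷_; [_]; length; _++_; map; concatMap; filter; filterᵇ;
  allFin; reverse; _ʳ++_)
open import Data.List.Membership.Propositional using (_∈_; _∉_)
open import Data.List.Membership.Propositional.Properties
  using (∈-∃++; ∈-++⁺ˡ; ∈-++⁺ʳ; ∈-++⁻; ∈-filter⁺; ∈-filter⁻; ∈-concat⁺′; ∈-concatMap⁻; ∈-map⁺; ∈-allFin)
open import Data.List.Properties
  using (≡-dec; length-++; length-++-sucʳ; length-tabulate; length-reverse; length-ʳ++; filter-++;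
    filter-none; ʳ++-defn; ++-identityʳ; ++-cancelʳ; reverse-involutive; ∷-injectiveˡ)
open import Data.List.Relation.Binary.Subset.Propositional using (_⊆_)
open import Data.List.Relation.Unary.Any using (here; there; satisfied)
open import Data.List.Relation.Unary.All as All using (All; []; _∷_)
open import Data.List.Relation.Unary.AllPairs using ([]; _∷_)
import Data.List.Relation.Unary.All.Properties as All
import Data.List.Relation.Unary.AllPairs.Properties as AllPairs
open import Data.List.Relation.Unary.Unique.Propositional using (Unique)
import Data.List.Relation.Unary.Unique.Propositional.Properties as Unique
open import Data.Nat using (ℕ; zero; suc; _+_; _*_; _∸_; _^_; _≤_; _<_; z≤n; s≤s)
open import Data.Nat.DivMod using (_/_; _%_; [m+kn]%n≡m%n; m/n≡1+[m∸n]/n; m*n/n≡m; m≡m%n+[m/n]*n; m%n<n)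
open import Data.Nat.ListAction using (sum)
open import Data.Nat.Properties
open import Algebra.Properties.CommutativeSemigroup +-commutativeSemigroup using (interchange; x∙yz≈y∙xz)
open import Data.Nat.Tactic.RingSolver using (solve-∀)
open import Data.Product using (_×_; _,_; proj₁; proj₂; ∃-syntax)
open import Data.Sum using (_⊎_; inj₁; inj₂; swap)
import Data.Sum as Sum
open import Data.Unit using (tt)
open import Function using (_∘_; id)
open import Function.Bundles using (_⇔_; Equivalence)
open import Relation.Binary.Definitions using (DecidableEquality)
open import Relation.Binary.PropositionalEquality
  using (_≡_; _≢_; refl; sym; trans; cong; cong₂; subst; module ≡-Reasoning)
open import Relation.Nullary using (¬_; yes; no; does)
open import Relation.Nullary.Decidable using (dec-true; T?)
open import Relation.Unary using (Decidable)

𝟙 : Bool → ℕ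
𝟙 true  = 1
𝟙 false = 0

module _ {A : Set} where

  Unique⇒length≤ : {xs ys : List A} → Unique xs → xs ⊆ ys → length xs ≤ length ys
  Unique⇒length≤ {[]}     _              _   = z≤n
  Unique⇒length≤ {x ∷ xs} (x∉xs ∷ uxs) xs⊆ys
    with ys₁ , ys₂ , refl ← ∈-∃++ (xs⊆ys (here refl)) =
    ≤-trans (s≤s (Unique⇒length≤ uxs xs⊆ys₁ys₂)) (≤-reflexive (sym (length-++-sucʳ ys₁ x ys₂)))
    where
    xs⊆ys₁ys₂ : xs ⊆ ys₁ ++ ys₂
    xs⊆ys₁ys₂ {y} y∈xs with ∈-++⁻ ys₁ (xs⊆ys (there y∈xs))
    ... | inj₁ y∈ys₁         = ∈-++⁺ˡ y∈ys₁
    ... | inj₂ (here refl)   = ⊥-elim (All.lookup x∉xs y∈xs refl)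
    ... | inj₂ (there y∈ys₂) = ∈-++⁺ʳ ys₁ y∈ys₂

  ʳ++-cancelʳ : (xs ys : List A) {zs : List A} → xs ʳ++ zs ≡ ys ʳ++ zs → xs ≡ ys
  ʳ++-cancelʳ xs ys {zs} eq = begin
    xs                   ≡⟨ reverse-involutive xs ⟨
    reverse (reverse xs) ≡⟨ cong reverse reversed ⟩
    reverse (reverse ys) ≡⟨ reverse-involutive ys ⟩
    ys                   ∎
    where
    open ≡-Reasoning
    reversed : reverse xs ≡ reverse ys
    reversed = ++-cancelʳ zs (reverse xs) (reverse ys)
      (trans (sym (ʳ++-defn xs)) (trans eq (ʳ++-defn ys)))

  sum-map-mono : {f g : A → ℕ} → (∀ x → f x ≤ g x) → ∀ xs → sum (map f xs) ≤ sum (map g xs)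
  sum-map-mono f≤g []       = z≤n
  sum-map-mono f≤g (x ∷ xs) = +-mono-≤ (f≤g x) (sum-map-mono f≤g xs)

  sum-map-const : {f : A → ℕ} {v : ℕ} → (∀ x → f x ≡ v) → ∀ xs → sum (map f xs) ≡ length xs * v
  sum-map-const f≡v []       = refl
  sum-map-const f≡v (x ∷ xs) = cong₂ _+_ (f≡v x) (sum-map-const f≡v xs)

  sum-map-shift : ∀ v (f : A → ℕ) xs → sum (map (λ x → v + f x) xs) ≡ length xs * v + sum (map f xs)
  sum-map-shift v f []       = refl
  sum-map-shift v f (x ∷ xs) = trans (cong (v + f x +_) (sum-map-shift v f xs))
                                     (interchange v (f x) (length xs * v) (sum (map f xs)))

length-allFin : ∀ n → length (allFin n) ≡ n
length-allFin n = length-tabulate id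

module _ {A : Set} {P : A → Set} (P? : Decidable P) where

  length-filter-∷ : ∀ x xs → length (filter P? (x ∷ xs)) ≡ 𝟙 (does (P? x)) + length (filter P? xs)
  length-filter-∷ x xs with does (P? x)
  ... | true  = refl
  ... | false = refl

  sum-map-𝟙 : ∀ xs → sum (map (λ x → 𝟙 (does (P? x))) xs) ≡ length (filter P? xs)
  sum-map-𝟙 []       = refl
  sum-map-𝟙 (x ∷ xs) = trans (cong (_ +_) (sum-map-𝟙 xs)) (sym (length-filter-∷ x xs))

  length-filter-concatMap : {B : Set} (f : B → List A) (xs : List B) →
    length (filter P? (concatMap f xs)) ≡ sum (map (λ x → length (filter P? (f x))) xs)
  length-filter-concatMap f []       = refl
  length-filter-concatMap f (x ∷ xs) = begin
    length (filter P? (f x ++ concatMap f xs))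
      ≡⟨ cong length (filter-++ P? (f x) (concatMap f xs)) ⟩
    length (filter P? (f x) ++ filter P? (concatMap f xs))
      ≡⟨ length-++ (filter P? (f x)) ⟩
    length (filter P? (f x)) + length (filter P? (concatMap f xs))
      ≡⟨ cong (_ +_) (length-filter-concatMap f xs) ⟩
    length (filter P? (f x)) + sum (map (λ x → length (filter P? (f x))) xs) ∎
    where open ≡-Reasoning

TwoNeighboursIn : {A : Set} → (A → A → Set) → (A → Set) → A → Set
TwoNeighboursIn Adj T y = ∃[ a ] ∃[ a′ ] (a ≢ a′ × T a × T a′ × Adj y a × Adj y a′)

module _ {A : Set} (V : A → Set) (Adj : A → A → Set) {S : A → Set} (red : IsRedLD V Adj S) where

  member⇒neighbourIn : ∀ v → V v → S v → ∃[ w ] (S w × Adj v w)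
  member⇒neighbourIn v Vv Sv =
    let w , (Sw , _) , vw = proj₁ (proj₂ red v Sv v v Vv Vv v∉S-v v∉S-v) in w , Sw , vw
    where
    v∉S-v : ¬ (S v × v ≢ v)
    v∉S-v (_ , v≢v) = v≢v refl

  nonmember⇒twoNeighboursIn : ∀ v → V v → ¬ S v → TwoNeighboursIn Adj S v
  nonmember⇒twoNeighboursIn v Vv v∉S =
    let a , Sa , va = proj₁ (proj₁ red v v Vv Vv v∉S v∉S)
        a′ , (Sa′ , a′≢a) , va′ = proj₁ (proj₂ red a Sa v v Vv Vv (v∉S ∘ proj₁) (v∉S ∘ proj₁))
    in a , a′ , (λ a≡a′ → a′≢a (sym a≡a′)) , Sa , Sa′ , va , va′

module _ {A : Set} (V : A → Set) (Adj : A → A → Set)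
         (no-triangle : ∀ {u v w} → Adj u v → Adj v w → Adj u w → ⊥)
         (no-4-cycle : ∀ {u v a a′} → u ≢ v → a ≢ a′ → Adj u a → Adj u a′ → Adj v a → Adj v a′ → ⊥)
         where

  -- Two vertices outside T with the same T-neighbours would either have two common
  -- neighbours, or both lie in E and so form a triangle with a common T-neighbour.
  twoNeighbours⇒isLD : (T E : A → Set) →
    (∀ v → V v → ¬ T v → ∃[ w ] (T w × Adj v w)) →
    (∀ v → V v → ¬ T v → TwoNeighboursIn Adj T v ⊎ E v) →
    (∀ {u v} → E u → E v → u ≢ v → Adj u v) →
    IsLD V Adj T
  twoNeighbours⇒isLD T E dominated classify E-adjacent u v Vu Vv u∉T v∉T =
    dominated v Vv v∉T , separated
    where
    shared : ∀ {y z} → y ≢ z → TwoNeighboursIn Adj T z → (∀ w → T w → Adj z w → Adj y w) → ⊥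
    shared y≢z (a , a′ , a≢a′ , Ta , Ta′ , za , za′) z⇒y =
      no-4-cycle y≢z a≢a′ (z⇒y a Ta za) (z⇒y a′ Ta′ za′) za za′

    separated : u ≢ v → ¬ (∀ w → T w → (Adj u w ⇔ Adj v w))
    separated u≢v same = go (classify u Vu u∉T) (classify v Vv v∉T)
      where
      go : TwoNeighboursIn Adj T u ⊎ E u → TwoNeighboursIn Adj T v ⊎ E v → ⊥
      go _          (inj₁ two) = shared u≢v two (λ w Tw → Equivalence.from (same w Tw))
      go (inj₁ two) _          = shared (u≢v ∘ sym) two (λ w Tw → Equivalence.to (same w Tw))
      go (inj₂ Eu)  (inj₂ Ev)  =
        let a , Ta , ua = dominated u Vu u∉T
        in no-triangle (E-adjacent Eu Ev u≢v) (Equivalence.to (same a Ta) ua) ua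

module _ {A : Set} (_≟_ : DecidableEquality A) {Adj : A → A → Set} {T : A → Set} {y : A} (x : A) where

  neighbour-avoiding : ∀ {a b} → a ≢ b → T a → T b → Adj y a → Adj y b → ∃[ w ] ((T w × w ≢ x) × Adj y w)
  neighbour-avoiding {a} {b} a≢b Ta Tb ya yb with a ≟ x
  ... | yes refl = b , (Tb , a≢b ∘ sym) , yb
  ... | no a≢x   = a , (Ta , a≢x) , ya

  twoNeighbours-avoiding : ∀ {a b} → a ≢ b → T a → T b → Adj y a → Adj y b →
    TwoNeighboursIn Adj (λ w → T w × w ≢ x) y ⊎ Adj y x
  twoNeighbours-avoiding {a} {b} a≢b Ta Tb ya yb with a ≟ x | b ≟ x
  ... | yes refl | _        = inj₂ ya
  ... | no _     | yes refl = inj₂ yb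
  ... | no a≢x   | no b≢x   = inj₁ (a , b , a≢b , (Ta , a≢x) , (Tb , b≢x) , ya , yb)

  threeNeighbours-avoiding : ∀ {a b c} → a ≢ b → a ≢ c → b ≢ c → T a → T b → T c →
    Adj y a → Adj y b → Adj y c → TwoNeighboursIn Adj (λ w → T w × w ≢ x) y
  threeNeighbours-avoiding {a} {b} {c} a≢b a≢c b≢c Ta Tb Tc ya yb yc with a ≟ x | b ≟ x
  ... | yes refl | _        = b , c , b≢c , (Tb , a≢b ∘ sym) , (Tc , a≢c ∘ sym) , yb , yc
  ... | no a≢x   | yes refl = a , c , a≢c , (Ta , a≢x) , (Tc , b≢c ∘ sym) , ya , yc
  ... | no a≢x   | no b≢x   = a , b , a≢b , (Ta , a≢x) , (Tb , b≢x) , ya , yb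

module Tree (k : ℕ) where

  Vertex : Set
  Vertex = List (Fin k)

  _≟ᵥ_ : DecidableEquality Vertex
  _≟ᵥ_ = ≡-dec _≟ᶠ_

  Adj : Vertex → Vertex → Set
  Adj = TreeAdj k

  adj-irrefl : ∀ {v} → ¬ Adj v v
  adj-irrefl (inj₁ (_ , ()))
  adj-irrefl (inj₂ (_ , ()))

  adj-sym : ∀ {u v} → Adj u v → Adj v u
  adj-sym = swap

  no-triangle : ∀ {u v w} → Adj u v → Adj v w → Adj u w → ⊥
  no-triangle (inj₁ (_ , refl)) (inj₁ (_ , refl)) (inj₁ (_ , ()))
  no-triangle (inj₁ (_ , refl)) (inj₁ (_ , refl)) (inj₂ (_ , ()))
  no-triangle (inj₁ (_ , refl)) (inj₂ (_ , refl)) uw                = adj-irrefl uw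
  no-triangle (inj₂ (_ , refl)) (inj₁ (_ , refl)) (inj₁ (_ , ()))
  no-triangle (inj₂ (_ , refl)) (inj₁ (_ , refl)) (inj₂ (_ , ()))
  no-triangle (inj₂ (_ , refl)) (inj₂ (_ , refl)) (inj₁ (_ , ()))
  no-triangle (inj₂ (_ , refl)) (inj₂ (_ , refl)) (inj₂ (_ , ()))

  no-4-cycle : ∀ {u v a a′} → u ≢ v → a ≢ a′ → Adj u a → Adj u a′ → Adj v a → Adj v a′ → ⊥
  no-4-cycle u≢v _    (inj₁ (_ , refl)) _                 (inj₁ (_ , refl)) _                 = u≢v refl
  no-4-cycle _   _    (inj₁ (_ , refl)) (inj₁ (_ , refl)) (inj₂ (_ , refl)) (inj₁ (_ , ()))
  no-4-cycle _   a≢a′ (inj₁ (_ , refl)) (inj₁ (_ , refl)) (inj₂ (_ , refl)) (inj₂ (_ , refl)) = a≢a′ refl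
  no-4-cycle _   _    (inj₁ (_ , refl)) (inj₂ (_ , refl)) (inj₂ (_ , refl)) (inj₁ (_ , ()))
  no-4-cycle _   _    (inj₁ (_ , refl)) (inj₂ (_ , refl)) (inj₂ (_ , refl)) (inj₂ (_ , ()))
  no-4-cycle _   _    (inj₂ (_ , refl)) (inj₁ (_ , refl)) (inj₁ (_ , refl)) (inj₁ (_ , ()))
  no-4-cycle _   _    (inj₂ (_ , refl)) (inj₁ (_ , refl)) (inj₁ (_ , refl)) (inj₂ (_ , ()))
  no-4-cycle u≢v _    (inj₂ (_ , refl)) (inj₁ (_ , refl)) (inj₂ (_ , refl)) (inj₁ (_ , refl)) = u≢v refl
  no-4-cycle _   _    (inj₂ (_ , refl)) (inj₁ (_ , refl)) (inj₂ (_ , refl)) (inj₂ (_ , ()))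
  no-4-cycle _   a≢a′ (inj₂ (_ , refl)) (inj₂ (_ , refl)) _                 _                 = a≢a′ refl

  grandchild≢ : ∀ {a b} (w : Vertex) → a ∷ b ∷ w ≢ w
  grandchild≢ w eq = m≢1+n+m (length w) (sym (cong length eq))

  subtree : Vertex → ℕ → List Vertex
  subtree u zero    = [ u ]
  subtree u (suc h) = u ∷ concatMap (λ c → subtree (c ∷ u) h) (allFin k)

  ∈-branch⁻ : ∀ h {u v} → v ∈ concatMap (λ c → subtree (c ∷ u) h) (allFin k) →
              ∃[ c ] (v ∈ subtree (c ∷ u) h)
  ∈-branch⁻ h {u} v∈ = satisfied (∈-concatMap⁻ (λ c → subtree (c ∷ u) h) {xs = allFin k} v∈)

  ∈-subtree⁻ : ∀ h {u v} → v ∈ subtree u h → ∃[ w ] (length w ≤ h × v ≡ w ʳ++ u)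
  ∈-subtree⁻ zero    (here refl)  = [] , z≤n , refl
  ∈-subtree⁻ (suc h) (here refl)  = [] , z≤n , refl
  ∈-subtree⁻ (suc h) (there v∈)
    with c , v∈′ ← ∈-branch⁻ h v∈
    with w , |w|≤h , refl ← ∈-subtree⁻ h v∈′ = c ∷ w , s≤s |w|≤h , refl

  ∈-subtree⁺ : ∀ h u (w : Vertex) → length w ≤ h → w ʳ++ u ∈ subtree u h
  ∈-subtree⁺ zero    u []      _          = here refl
  ∈-subtree⁺ (suc h) u []      _          = here refl
  ∈-subtree⁺ (suc h) u (c ∷ w) (s≤s |w|≤h) =
    there (∈-concat⁺′ (∈-subtree⁺ h (c ∷ u) w |w|≤h) (∈-map⁺ (λ c → subtree (c ∷ u) h) (∈-allFin c)))

  subtree-unique : ∀ h u → Unique (subtree u h)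
  subtree-unique zero    u = [] ∷ []
  subtree-unique (suc h) u =
    All.tabulate root∉ ∷ Unique.concat⁺ (All.map⁺ (All.universal (λ c → subtree-unique h (c ∷ u)) _))
                                        (AllPairs.map⁺ (AllPairs.tabulate⁺ disjoint))
    where
    root∉ : ∀ {v} → v ∈ concatMap (λ c → subtree (c ∷ u) h) (allFin k) → u ≢ v
    root∉ v∈ u≡v with c , v∈′ ← ∈-branch⁻ h v∈
      with w , _ , refl ← ∈-subtree⁻ h v∈′ with () ← ʳ++-cancelʳ [] (c ∷ w) u≡v

    disjoint : ∀ {c c′} → c ≢ c′ → ∀ {v} → ¬ (v ∈ subtree (c ∷ u) h × v ∈ subtree (c′ ∷ u) h)
    disjoint c≢c′ (v∈ , v∈′) with w , _ , refl ← ∈-subtree⁻ h v∈ | w′ , _ , eq ← ∈-subtree⁻ h v∈′ =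
      c≢c′ (∷-injectiveˡ (ʳ++-cancelʳ (_ ∷ w) (_ ∷ w′) eq))

  ∈-wholeTree⁺ : ∀ {d v} → length v ≤ d → v ∈ subtree [] d
  ∈-wholeTree⁺ {d} {v} |v|≤d = subst (_∈ subtree [] d) v≡ (∈-subtree⁺ d [] (reverse v) |v|≤d′)
    where
    v≡ : reverse v ʳ++ [] ≡ v
    v≡ = trans (ʳ++-defn (reverse v)) (trans (++-identityʳ (reverse (reverse v))) (reverse-involutive v))
    |v|≤d′ : length (reverse v) ≤ d
    |v|≤d′ = subst (_≤ d) (sym (length-reverse v)) |v|≤d

  ∈-wholeTree⁻ : ∀ {d v} → v ∈ subtree [] d → length v ≤ d
  ∈-wholeTree⁻ {d} v∈ with w , |w|≤d , refl ← ∈-subtree⁻ d v∈ =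
    subst (_≤ d) (sym (trans (length-ʳ++ w) (+-identityʳ _))) |w|≤d

data Residue : Set where
  r₀ r₁ r₂ : Residue

next : Residue → Residue
next r₀ = r₁
next r₁ = r₂
next r₂ = r₀

residue : ℕ → Residue
residue zero    = r₀
residue (suc n) = next (residue n)

kept : Residue → Bool
kept r₂ = false
kept _  = true

isR₀ : Residue → Bool
isR₀ r₀ = true
isR₀ _  = false

kept-next : ∀ q → q ≢ r₁ → T (kept (next q))
kept-next r₀ _    = tt
kept-next r₁ q≢r₁ = ⊥-elim (q≢r₁ refl)
kept-next r₂ _    = tt

¬kept⇒r₂ : ∀ q → ¬ T (kept q) → q ≡ r₂
¬kept⇒r₂ r₀ ¬kept = ⊥-elim (¬kept tt)
¬kept⇒r₂ r₁ ¬kept = ⊥-elim (¬kept tt)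
¬kept⇒r₂ r₂ _     = refl

next≡r₀⇒¬kept : ∀ q → next q ≡ r₀ → ¬ T (kept q)
next≡r₀⇒¬kept r₂ _ ()

next≢r₀⇒kept : ∀ q → next q ≢ r₀ → T (kept q)
next≢r₀⇒kept r₀ _      = tt
next≢r₀⇒kept r₁ _      = tt
next≢r₀⇒kept r₂ nq≢r₀ = ⊥-elim (nq≢r₀ refl)

kept-pred : ∀ h → residue h ≢ r₀ → ∃[ h′ ] (h ≡ suc h′ × T (kept (residue h′)))
kept-pred zero    h≢r₀ = ⊥-elim (h≢r₀ refl)
kept-pred (suc h) h≢r₀ = h , refl , next≢r₀⇒kept (residue h) h≢r₀

keptInSubtree : ℕ → ℕ → ℕ
keptInSubtree k zero    = 1
keptInSubtree k (suc h) = 𝟙 (kept (residue (suc h))) + k * keptInSubtree k h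

redLD : ℕ → ℕ → ℕ
redLD k d = keptInSubtree k d + 𝟙 (isR₀ (residue d))

module LowerBound (k : ℕ) (k≥1 : 1 ≤ k) where

  open Tree k

  -- What S ∩ subtree u is guaranteed to contain beyond keptInSubtree (count-bound), given the
  -- residue of the height of u and whether its parent (p) and u itself (r) lie in S.
  surplus : Residue → Bool → Bool → ℕ
  surplus r₀ p r = 𝟙 (not p)
  surplus r₁ p r = if r then 0 else k ∸ 1
  surplus r₂ p r = 𝟙 r

  surplus-root : ∀ q r → 𝟙 (isR₀ q) ≤ surplus q false r
  surplus-root r₀ r = ≤-refl
  surplus-root r₁ r = z≤n
  surplus-root r₂ r = z≤n

  surplus-leaf : ∀ p r → 2 ≤ 𝟙 p + 𝟙 r + 0 → 1 + 𝟙 (not p) ≤ 𝟙 r + 0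
  surplus-leaf true  true  _               = ≤-refl
  surplus-leaf true  false (s≤s ())
  surplus-leaf false true  (s≤s ())
  surplus-leaf false false ()

  surplus-next : ∀ q v p r {P : Fin k → Set} (P? : Decidable P) →
    2 ≤ 𝟙 p + 𝟙 r + length (filter P? (allFin k)) →
    𝟙 (kept (next q)) + k * v + surplus (next q) p r
      ≤ 𝟙 r + (k * v + sum (map (λ c → surplus q r (does (P? c))) (allFin k)))
  surplus-next r₀ v p true  P? _ = s≤s (≤-trans (≤-reflexive (+-identityʳ _)) (m≤m+n _ _))
  surplus-next r₀ v p false P? _ = ≤-reflexive (begin
    1 + k * v + (k ∸ 1)                 ≡⟨ cong (_+ (k ∸ 1)) (+-comm 1 (k * v)) ⟩
    k * v + 1 + (k ∸ 1)                 ≡⟨ +-assoc (k * v) 1 (k ∸ 1) ⟩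
    k * v + (1 + (k ∸ 1))               ≡⟨ cong (k * v +_) (m+[n∸m]≡n k≥1) ⟩
    k * v + k                           ≡⟨ cong (k * v +_) (sym (*-identityʳ k)) ⟩
    k * v + k * 1                       ≡⟨ cong (λ m → k * v + m * 1) (length-allFin k) ⟨
    k * v + length (allFin k) * 1       ≡⟨ cong (k * v +_) (sum-map-const (λ _ → refl) (allFin k)) ⟨
    k * v + sum (map (λ _ → 1) (allFin k)) ∎)
    where open ≡-Reasoning
  surplus-next r₁ v p r P? _ = begin
    k * v + 𝟙 r                         ≡⟨ +-comm (k * v) (𝟙 r) ⟩
    𝟙 r + k * v                         ≤⟨ +-monoʳ-≤ (𝟙 r) (m≤m+n (k * v) _) ⟩
    𝟙 r + (k * v + _)                   ∎
    where open ≤-Reasoning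
  surplus-next r₂ v p r P? closed = begin
    1 + k * v + 𝟙 (not p)               ≡⟨ cong (_+ 𝟙 (not p)) (+-comm 1 (k * v)) ⟩
    k * v + 1 + 𝟙 (not p)               ≡⟨ +-assoc (k * v) 1 (𝟙 (not p)) ⟩
    k * v + (1 + 𝟙 (not p))             ≤⟨ +-monoʳ-≤ (k * v) (+-cancelˡ-≤ (𝟙 p) _ _ two≤) ⟩
    k * v + (𝟙 r + n)                   ≡⟨ x∙yz≈y∙xz (k * v) (𝟙 r) n ⟩
    𝟙 r + (k * v + n)                   ≡⟨ cong (λ m → 𝟙 r + (k * v + m)) (sum-map-𝟙 P? (allFin k)) ⟨
    𝟙 r + (k * v + sum (map (λ c → 𝟙 (does (P? c))) (allFin k))) ∎
    where
    open ≤-Reasoning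
    n = length (filter P? (allFin k))
    two≤ : 𝟙 p + (1 + 𝟙 (not p)) ≤ 𝟙 p + (𝟙 r + n)
    two≤ = ≤-trans (≤-reflexive (𝟙-complement p)) (≤-trans closed (≤-reflexive (+-assoc (𝟙 p) (𝟙 r) n)))
      where
      𝟙-complement : ∀ b → 𝟙 b + (1 + 𝟙 (not b)) ≡ 2
      𝟙-complement true  = refl
      𝟙-complement false = refl

  surplus-step : ∀ q v p r {P : Fin k → Set} (P? : Decidable P) (f : Fin k → ℕ) →
    (∀ c → v + surplus q r (does (P? c)) ≤ f c) →
    2 ≤ 𝟙 p + 𝟙 r + length (filter P? (allFin k)) →
    𝟙 (kept (next q)) + k * v + surplus (next q) p r ≤ 𝟙 r + sum (map f (allFin k))
  surplus-step q v p r P? f children closed = begin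
    𝟙 (kept (next q)) + k * v + surplus (next q) p r
      ≤⟨ surplus-next q v p r P? closed ⟩
    𝟙 r + (k * v + sum (map e (allFin k)))
      ≡⟨ cong (λ m → 𝟙 r + (m * v + sum (map e (allFin k)))) (length-allFin k) ⟨
    𝟙 r + (length (allFin k) * v + sum (map e (allFin k)))
      ≡⟨ cong (𝟙 r +_) (sum-map-shift v e (allFin k)) ⟨
    𝟙 r + sum (map (λ c → v + e c) (allFin k))
      ≤⟨ +-monoʳ-≤ (𝟙 r) (sum-map-mono children (allFin k)) ⟩
    𝟙 r + sum (map f (allFin k)) ∎
    where
    open ≤-Reasoning
    e : Fin k → ℕ
    e c = surplus q r (does (P? c))

  module _ (d : ℕ) (S : List Vertex) (S-vertices : All (TreeV k d) S)
           (red : IsRedLD (TreeV k d) Adj (_∈ S)) where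

    open import Data.List.Membership.DecPropositional _≟ᵥ_ using (_∈?_)

    inS : Vertex → Bool
    inS v = does (v ∈? S)

    parentInS : Vertex → Bool
    parentInS []      = false
    parentInS (_ ∷ w) = inS w

    childInS? : ∀ u → Decidable (λ c → (c ∷ u) ∈ S)
    childInS? u c = (c ∷ u) ∈? S

    childrenInS : Vertex → ℕ
    childrenInS u = length (filter (childInS? u) (allFin k))

    count : Vertex → ℕ → ℕ
    count u h = length (filter (_∈? S) (subtree u h))

    count-suc : ∀ u h → count u (suc h) ≡ 𝟙 (inS u) + sum (map (λ c → count (c ∷ u) h) (allFin k))
    count-suc u h = trans (length-filter-∷ (_∈? S) u _)
      (cong (𝟙 (inS u) +_) (length-filter-concatMap (_∈? S) (λ c → subtree (c ∷ u) h) (allFin k)))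

    childrenInS≥ : ∀ u {cs} → Unique cs → All (λ c → (c ∷ u) ∈ S) cs → length cs ≤ childrenInS u
    childrenInS≥ u uniq cs∈S =
      Unique⇒length≤ uniq (λ c∈cs → ∈-filter⁺ (childInS? u) (∈-allFin _) (All.lookup cs∈S c∈cs))

    leaf-childrenInS : ∀ u → length u ≡ d → childrenInS u ≡ 0
    leaf-childrenInS u |u|≡d = cong length (filter-none (childInS? u) (All.universal child∉S (allFin k)))
      where
      child∉S : ∀ c → (c ∷ u) ∉ S
      child∉S c c∷u∈S = 1+n≰n (subst (λ m → suc m ≤ d) |u|≡d (All.lookup S-vertices c∷u∈S))

    member-closed-neighbourhood : ∀ u {w} → w ∈ S → Adj u w → 2 ≤ 𝟙 (parentInS u) + 1 + childrenInS u
    member-closed-neighbourhood u w∈S (inj₁ (c , refl)) = begin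
      2                                       ≤⟨ s≤s (childrenInS≥ u ([] ∷ []) (w∈S ∷ [])) ⟩
      1 + childrenInS u                       ≤⟨ m≤n+m _ (𝟙 (parentInS u)) ⟩
      𝟙 (parentInS u) + (1 + childrenInS u)   ≡⟨ +-assoc (𝟙 (parentInS u)) 1 _ ⟨
      𝟙 (parentInS u) + 1 + childrenInS u     ∎
      where open ≤-Reasoning
    member-closed-neighbourhood (c ∷ w) w∈S (inj₂ (c , refl))
      rewrite dec-true (w ∈? S) w∈S = s≤s (s≤s z≤n)

    nonmember-closed-neighbourhood : ∀ u → TwoNeighboursIn Adj (_∈ S) u →
      2 ≤ 𝟙 (parentInS u) + 0 + childrenInS u
    nonmember-closed-neighbourhood u (_ , _ , a≢a′ , a∈S , a′∈S , inj₁ (c , refl) , inj₁ (c′ , refl)) =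
      ≤-trans (childrenInS≥ u ((c≢c′ ∷ []) ∷ [] ∷ []) (a∈S ∷ a′∈S ∷ [])) (m≤n+m _ _)
      where
      c≢c′ : c ≢ c′
      c≢c′ = a≢a′ ∘ cong (_∷ u)
    nonmember-closed-neighbourhood (c′ ∷ w) (_ , _ , _ , a∈S , w∈S , inj₁ (c , refl) , inj₂ (c′ , refl))
      rewrite dec-true (w ∈? S) w∈S = s≤s (childrenInS≥ (c′ ∷ w) ([] ∷ []) (a∈S ∷ []))
    nonmember-closed-neighbourhood (c ∷ w) (_ , _ , _ , w∈S , a′∈S , inj₂ (c , refl) , inj₁ (c′ , refl))
      rewrite dec-true (w ∈? S) w∈S = s≤s (childrenInS≥ (c ∷ w) ([] ∷ []) (a′∈S ∷ []))
    nonmember-closed-neighbourhood (c ∷ w) (_ , _ , a≢a′ , _ , _ , inj₂ (c , refl) , inj₂ (c , refl)) =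
      ⊥-elim (a≢a′ refl)

    closed-neighbourhood : ∀ u → length u ≤ d → 2 ≤ 𝟙 (parentInS u) + 𝟙 (inS u) + childrenInS u
    closed-neighbourhood u |u|≤d with u ∈? S
    ... | yes u∈S = let _ , w∈S , uw = member⇒neighbourIn (TreeV k d) Adj red u |u|≤d u∈S
                    in member-closed-neighbourhood u w∈S uw
    ... | no u∉S  = nonmember-closed-neighbourhood u
                      (nonmember⇒twoNeighboursIn (TreeV k d) Adj red u |u|≤d u∉S)

    count-bound : ∀ h u → length u + h ≡ d →
      keptInSubtree k h + surplus (residue h) (parentInS u) (inS u) ≤ count u h
    count-bound zero u |u|+0≡d = begin
      1 + 𝟙 (not (parentInS u))   ≤⟨ surplus-leaf (parentInS u) (inS u) leaf-closed ⟩
      𝟙 (inS u) + 0               ≡⟨ length-filter-∷ (_∈? S) u [] ⟨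
      count u 0                   ∎
      where
      open ≤-Reasoning
      |u|≡d : length u ≡ d
      |u|≡d = trans (sym (+-identityʳ _)) |u|+0≡d
      leaf-closed : 2 ≤ 𝟙 (parentInS u) + 𝟙 (inS u) + 0
      leaf-closed = subst (λ m → 2 ≤ 𝟙 (parentInS u) + 𝟙 (inS u) + m) (leaf-childrenInS u |u|≡d)
                          (closed-neighbourhood u (≤-reflexive |u|≡d))
    count-bound (suc h) u |u|+h+1≡d = begin
      keptInSubtree k (suc h) + surplus (residue (suc h)) (parentInS u) (inS u)
        ≤⟨ surplus-step (residue h) (keptInSubtree k h) (parentInS u) (inS u) (childInS? u)
                        (λ c → count (c ∷ u) h) (λ c → count-bound h (c ∷ u) (|c∷u|+h≡d {c}))
                        (closed-neighbourhood u |u|≤d) ⟩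
      𝟙 (inS u) + sum (map (λ c → count (c ∷ u) h) (allFin k))
        ≡⟨ count-suc u h ⟨
      count u (suc h) ∎
      where
      open ≤-Reasoning
      |c∷u|+h≡d : ∀ {c : Fin k} → length (c ∷ u) + h ≡ d
      |c∷u|+h≡d = trans (sym (+-suc (length u) h)) |u|+h+1≡d
      |u|≤d : length u ≤ d
      |u|≤d = subst (length u ≤_) |u|+h+1≡d (m≤m+n _ _)

    redLD≤length : Unique S → redLD k d ≤ length S
    redLD≤length S-unique = begin
      keptInSubtree k d + 𝟙 (isR₀ (residue d))
        ≤⟨ +-monoʳ-≤ (keptInSubtree k d) (surplus-root (residue d) (inS [])) ⟩
      keptInSubtree k d + surplus (residue d) false (inS [])
        ≤⟨ count-bound d [] refl ⟩
      count [] d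
        ≤⟨ Unique⇒length≤ (Unique.filter⁺ (_∈? S) (subtree-unique d []))
                          (λ v∈ → proj₂ (∈-filter⁻ (_∈? S) {xs = subtree [] d} v∈)) ⟩
      length S ∎
      where open ≤-Reasoning

module UpperBound (k′ d : ℕ) (d≥1 : 1 ≤ d) where

  k : ℕ
  k = suc (suc k′)

  open Tree k

  keptVertex : Vertex → Bool
  keptVertex v = kept (residue (d ∸ length v))

  -- When d ≡ 0 (mod 3) the root is kept but none of its children are, so one child is
  -- added to give the root a neighbour in the set.
  rootChild : Residue → List Vertex
  rootChild r₀ = [ zero ∷ [] ]
  rootChild _  = []

  ∈-rootChild⁻ : ∀ q {v} → v ∈ rootChild q → q ≡ r₀ × v ≡ zero ∷ []
  ∈-rootChild⁻ r₀ (here refl) = refl , refl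

  S₀ : List Vertex
  S₀ = rootChild (residue d) ++ filterᵇ keptVertex (subtree [] d)

  height : (v : Vertex) → length v ≤ d → ∃[ h ] (length v + h ≡ d)
  height v |v|≤d = d ∸ length v , m+[n∸m]≡n |v|≤d

  keptVertex-at : ∀ {v h} → length v + h ≡ d → keptVertex v ≡ kept (residue h)
  keptVertex-at {v} {h} |v|+h≡d = cong (kept ∘ residue) (trans (cong (_∸ length v) (sym |v|+h≡d))
                                                               (m+n∸m≡n (length v) h))

  kept-∈S₀ : ∀ {v h} → length v + h ≡ d → T (kept (residue h)) → v ∈ S₀
  kept-∈S₀ {v} |v|+h≡d kept-h = ∈-++⁺ʳ (rootChild (residue d))
    (∈-filter⁺ (T? ∘ keptVertex) (∈-wholeTree⁺ (subst (length v ≤_) |v|+h≡d (m≤m+n _ _)))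
               (subst T (sym (keptVertex-at {v} |v|+h≡d)) kept-h))

  rootChild-∈S₀ : residue d ≡ r₀ → (zero ∷ []) ∈ S₀
  rootChild-∈S₀ d≡r₀ = subst (λ q → (zero ∷ []) ∈ rootChild q ++ filterᵇ keptVertex (subtree [] d))
                             (sym d≡r₀) (here refl)

  ∈S₀⁻ : ∀ {v} → v ∈ S₀ →
    (residue d ≡ r₀ × v ≡ zero ∷ []) ⊎ ∃[ h ] (length v + h ≡ d × T (kept (residue h)))
  ∈S₀⁻ {v} v∈S₀ with ∈-++⁻ (rootChild (residue d)) v∈S₀
  ... | inj₁ v∈root = inj₁ (∈-rootChild⁻ (residue d) v∈root)
  ... | inj₂ v∈kept =
    let v∈tree , kept-v = ∈-filter⁻ (T? ∘ keptVertex) {xs = subtree [] d} v∈kept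
    in inj₂ (_ , m+[n∸m]≡n (∈-wholeTree⁻ v∈tree) , kept-v)

  child-∈S₀ : ∀ {v h} → length v + h ≡ d → residue h ≢ r₀ → ∀ c → (c ∷ v) ∈ S₀
  child-∈S₀ {v} {h} |v|+h≡d h≢r₀ c with h′ , refl , kept-h′ ← kept-pred h h≢r₀ =
    kept-∈S₀ (trans (sym (+-suc (length v) h′)) |v|+h≡d) kept-h′

  parent-∈S₀ : ∀ {c w h} → length (c ∷ w) + h ≡ d → residue h ≢ r₁ → w ∈ S₀
  parent-∈S₀ {w = w} {h} |cw|+h≡d h≢r₁ =
    kept-∈S₀ (trans (+-suc (length w) h) |cw|+h≡d) (kept-next (residue h) h≢r₁)

  nonmember-residue : ∀ {v h} → length v + h ≡ d → v ∉ S₀ → residue h ≡ r₂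
  nonmember-residue |v|+h≡d v∉S₀ = ¬kept⇒r₂ _ (v∉S₀ ∘ kept-∈S₀ |v|+h≡d)

  nonmember-children : ∀ {v} → length v ≤ d → v ∉ S₀ → ∀ c → (c ∷ v) ∈ S₀
  nonmember-children {v} |v|≤d v∉S₀ =
    let _ , |v|+h≡d = height v |v|≤d
    in child-∈S₀ {v} |v|+h≡d (subst (_≢ r₀) (sym (nonmember-residue |v|+h≡d v∉S₀)) (λ ()))

  nonmember-parent : ∀ {c w} → length (c ∷ w) ≤ d → (c ∷ w) ∉ S₀ → w ∈ S₀
  nonmember-parent {c} {w} |cw|≤d cw∉S₀ =
    let _ , |cw|+h≡d = height (c ∷ w) |cw|≤d
    in parent-∈S₀ {c} {w} |cw|+h≡d (subst (_≢ r₁) (sym (nonmember-residue |cw|+h≡d cw∉S₀)) (λ ()))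

  member-neighbour : ∀ {v} → v ∈ S₀ → ∃[ w ] (w ∈ S₀ × Adj v w)
  member-neighbour v∈S₀ with ∈S₀⁻ v∈S₀
  ... | inj₁ (d≡r₀ , refl) = [] , kept-∈S₀ refl (subst (T ∘ kept) (sym d≡r₀) tt) , inj₂ (zero , refl)
  ... | inj₂ (h , |v|+h≡d , _) = by-residue _ |v|+h≡d (residue h) refl
    where
    by-residue : ∀ v → length v + h ≡ d → ∀ q → residue h ≡ q → ∃[ w ] (w ∈ S₀ × Adj v w)
    by-residue []      h≡d r₀ h≡r₀ = zero ∷ [] , rootChild-∈S₀ (trans (cong residue (sym h≡d)) h≡r₀)
                                   , inj₁ (zero , refl)
    by-residue (c ∷ w) |cw|+h≡d r₀ h≡r₀ =
      w , parent-∈S₀ {c} {w} |cw|+h≡d (subst (_≢ r₁) (sym h≡r₀) (λ ())) , inj₂ (c , refl)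
    by-residue v |v|+h≡d r₁ h≡r₁ =
      zero ∷ v , child-∈S₀ {v} |v|+h≡d (subst (_≢ r₀) (sym h≡r₁) (λ ())) zero , inj₁ (zero , refl)
    by-residue v |v|+h≡d r₂ h≡r₂ =
      zero ∷ v , child-∈S₀ {v} |v|+h≡d (subst (_≢ r₀) (sym h≡r₂) (λ ())) zero , inj₁ (zero , refl)

  S₀-vertices : All (TreeV k d) S₀
  S₀-vertices = All.tabulate λ v∈S₀ → case-split (∈S₀⁻ v∈S₀)
    where
    case-split : ∀ {v} → (residue d ≡ r₀ × v ≡ zero ∷ []) ⊎
                         ∃[ h ] (length v + h ≡ d × T (kept (residue h))) → length v ≤ d
    case-split (inj₁ (_ , refl))          = d≥1
    case-split {v} (inj₂ (h , |v|+h≡d , _)) = subst (length v ≤_) |v|+h≡d (m≤m+n (length v) h)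

  S₀-unique : Unique S₀
  S₀-unique = Unique.++⁺ (rootChild-unique (residue d))
                         (Unique.filter⁺ (T? ∘ keptVertex) (subtree-unique d [])) disjoint
    where
    rootChild-unique : ∀ q → Unique (rootChild q)
    rootChild-unique r₀ = [] ∷ []
    rootChild-unique r₁ = []
    rootChild-unique r₂ = []

    rootChild-unkept : ∀ n → 1 ≤ n → residue n ≡ r₀ → ¬ T (kept (residue (n ∸ 1)))
    rootChild-unkept (suc n) _ = next≡r₀⇒¬kept (residue n)

    disjoint : ∀ {v} → ¬ (v ∈ rootChild (residue d) × v ∈ filterᵇ keptVertex (subtree [] d))
    disjoint (v∈root , v∈kept) with d≡r₀ , refl ← ∈-rootChild⁻ (residue d) v∈root =
      rootChild-unkept d d≥1 d≡r₀ (proj₂ (∈-filter⁻ (T? ∘ keptVertex) {xs = subtree [] d} v∈kept))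

  count-kept : ∀ h u → length u + h ≡ d → length (filterᵇ keptVertex (subtree u h)) ≡ keptInSubtree k h
  count-kept zero u |u|+0≡d = begin
    length (filterᵇ keptVertex [ u ])  ≡⟨ length-filter-∷ (T? ∘ keptVertex) u [] ⟩
    𝟙 (keptVertex u) + 0               ≡⟨ cong (λ b → 𝟙 b + 0) (keptVertex-at {u} |u|+0≡d) ⟩
    1                                  ∎
    where open ≡-Reasoning
  count-kept (suc h) u |u|+h+1≡d = begin
    length (filterᵇ keptVertex (subtree u (suc h)))
      ≡⟨ length-filter-∷ (T? ∘ keptVertex) u _ ⟩
    𝟙 (keptVertex u) + length (filterᵇ keptVertex (concatMap (λ c → subtree (c ∷ u) h) (allFin k)))
      ≡⟨ cong₂ _+_ (cong 𝟙 (keptVertex-at {u} |u|+h+1≡d))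
                   (length-filter-concatMap (T? ∘ keptVertex) (λ c → subtree (c ∷ u) h) (allFin k)) ⟩
    𝟙 (kept (residue (suc h))) + sum (map (λ c → length (filterᵇ keptVertex (subtree (c ∷ u) h))) (allFin k))
      ≡⟨ cong (𝟙 (kept (residue (suc h))) +_)
              (sum-map-const (λ c → count-kept h (c ∷ u) (|c∷u|+h≡d {c})) (allFin k)) ⟩
    𝟙 (kept (residue (suc h))) + length (allFin k) * keptInSubtree k h
      ≡⟨ cong (λ m → 𝟙 (kept (residue (suc h))) + m * keptInSubtree k h) (length-allFin k) ⟩
    keptInSubtree k (suc h) ∎
    where
    open ≡-Reasoning
    |c∷u|+h≡d : ∀ {c : Fin k} → length (c ∷ u) + h ≡ d
    |c∷u|+h≡d = trans (sym (+-suc (length u) h)) |u|+h+1≡d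

  length-S₀ : length S₀ ≡ redLD k d
  length-S₀ = begin
    length S₀
      ≡⟨ length-++ (rootChild (residue d)) ⟩
    length (rootChild (residue d)) + length (filterᵇ keptVertex (subtree [] d))
      ≡⟨ cong₂ _+_ (length-rootChild (residue d)) (count-kept d [] refl) ⟩
    𝟙 (isR₀ (residue d)) + keptInSubtree k d
      ≡⟨ +-comm (𝟙 (isR₀ (residue d))) (keptInSubtree k d) ⟩
    redLD k d ∎
    where
    open ≡-Reasoning
    length-rootChild : ∀ q → length (rootChild q) ≡ 𝟙 (isR₀ q)
    length-rootChild r₀ = refl
    length-rootChild r₁ = refl
    length-rootChild r₂ = refl

  firstChild≢secondChild : ∀ {v : Vertex} → zero ∷ v ≢ suc zero ∷ v
  firstChild≢secondChild ()

  nonmember-twoChildren : ∀ {v} → length v ≤ d → v ∉ S₀ → TwoNeighboursIn Adj (_∈ S₀) v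
  nonmember-twoChildren {v} |v|≤d v∉S₀ =
    zero ∷ v , suc zero ∷ v , firstChild≢secondChild , ch zero , ch (suc zero) ,
    inj₁ (zero , refl) , inj₁ (suc zero , refl)
    where
    ch : ∀ c → (c ∷ v) ∈ S₀
    ch = nonmember-children |v|≤d v∉S₀

  S₀-isLD : IsLD (TreeV k d) Adj (_∈ S₀)
  S₀-isLD = twoNeighbours⇒isLD (TreeV k d) Adj no-triangle no-4-cycle (_∈ S₀) (λ _ → ⊥) dominated
              (λ v |v|≤d v∉S₀ → inj₁ (nonmember-twoChildren |v|≤d v∉S₀)) (λ ())
    where
    dominated : ∀ v → length v ≤ d → v ∉ S₀ → ∃[ w ] (w ∈ S₀ × Adj v w)
    dominated v |v|≤d v∉S₀ =
      let a , _ , _ , a∈S₀ , _ , va , _ = nonmember-twoChildren |v|≤d v∉S₀ in a , a∈S₀ , va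

  S₀-minus-isLD : ∀ x → x ∈ S₀ → IsLD (TreeV k d) Adj (λ w → w ∈ S₀ × w ≢ x)
  S₀-minus-isLD x x∈S₀ =
    twoNeighbours⇒isLD (TreeV k d) Adj no-triangle no-4-cycle T₀ E dominated classify E-adjacent
    where
    T₀ : Vertex → Set
    T₀ w = w ∈ S₀ × w ≢ x

    -- Only x itself, and the root when x is one of its children, can have a single T₀-neighbour.
    E : Vertex → Set
    E y = y ≡ x ⊎ (y ≡ [] × Adj [] x)

    dominated : ∀ v → length v ≤ d → ¬ T₀ v → ∃[ w ] (T₀ w × Adj v w)
    dominated v |v|≤d v∉T with v ≟ᵥ x
    ... | yes refl = let w , w∈S₀ , vw = member-neighbour x∈S₀
                     in w , (w∈S₀ , λ w≡x → adj-irrefl (subst (Adj x) w≡x vw)) , vw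
    ... | no v≢x   =
      let a , b , a≢b , a∈S₀ , b∈S₀ , va , vb = nonmember-twoChildren |v|≤d (λ v∈S₀ → v∉T (v∈S₀ , v≢x))
      in neighbour-avoiding _≟ᵥ_ {Adj = Adj} {T = _∈ S₀} x a≢b a∈S₀ b∈S₀ va vb

    outside : ∀ v → length v ≤ d → v ∉ S₀ → TwoNeighboursIn Adj T₀ v ⊎ E v
    outside [] |v|≤d v∉S₀ =
      let a , b , a≢b , a∈S₀ , b∈S₀ , va , vb = nonmember-twoChildren |v|≤d v∉S₀
      in Sum.map₂ (λ root-x → inj₂ (refl , root-x))
                  (twoNeighbours-avoiding _≟ᵥ_ {Adj = Adj} {T = _∈ S₀} x a≢b a∈S₀ b∈S₀ va vb)
    outside (c ∷ w) |v|≤d v∉S₀ =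
      let a , b , a≢b , a∈S₀ , b∈S₀ , va , vb = nonmember-twoChildren |v|≤d v∉S₀
      in inj₁ (threeNeighbours-avoiding _≟ᵥ_ {Adj = Adj} {T = _∈ S₀} x a≢b (grandchild≢ w) (grandchild≢ w)
                                        a∈S₀ b∈S₀ (nonmember-parent |v|≤d v∉S₀) va vb (inj₂ (c , refl)))

    classify : ∀ v → length v ≤ d → ¬ T₀ v → TwoNeighboursIn Adj T₀ v ⊎ E v
    classify v |v|≤d v∉T with v ≟ᵥ x
    ... | yes v≡x = inj₂ (inj₁ v≡x)
    ... | no v≢x  = outside v |v|≤d (λ v∈S₀ → v∉T (v∈S₀ , v≢x))

    E-adjacent : ∀ {u v} → E u → E v → u ≢ v → Adj u v
    E-adjacent (inj₁ refl)         (inj₁ refl)         u≢v = ⊥-elim (u≢v refl)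
    E-adjacent (inj₁ refl)         (inj₂ (refl , r-x)) _   = adj-sym r-x
    E-adjacent (inj₂ (refl , r-x)) (inj₁ refl)         _   = r-x
    E-adjacent (inj₂ (refl , _))   (inj₂ (refl , _))   u≢v = ⊥-elim (u≢v refl)

  redLD-set : ∃[ S ] (Unique S × All (TreeV k d) S × IsRedLD (TreeV k d) Adj (_∈ S) × length S ≡ redLD k d)
  redLD-set = S₀ , S₀-unique , S₀-vertices , (S₀-isLD , S₀-minus-isLD) , length-S₀

redLD-tree : ∀ k′ d → 1 ≤ d → RedLDTree (suc (suc k′)) d (redLD (suc (suc k′)) d)
redLD-tree k′ d d≥1 = UpperBound.redLD-set k′ d d≥1 , λ S S-unique S-vertices red →
  LowerBound.redLD≤length (suc (suc k′)) (s≤s z≤n) d S S-vertices red S-unique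

m*n/′n≡m : ∀ m n → 1 ≤ n → (m * n) /' n ≡ m
m*n/′n≡m m (suc n) _ = m*n/n≡m m (suc n)

ceil3-+3 : ∀ n → ceil3 (3 + n) ≡ suc (ceil3 n)
ceil3-+3 n = m/n≡1+[m∸n]/n {3 + n + 2} {3} (s≤s (s≤s (s≤s z≤n)))

ceil3-+3j : ∀ r j → ceil3 (r + j * 3) ≡ ceil3 r + j
ceil3-+3j r zero    = trans (cong ceil3 (+-identityʳ r)) (sym (+-identityʳ _))
ceil3-+3j r (suc j) = begin
  ceil3 (r + (3 + j * 3))  ≡⟨ cong ceil3 (x∙yz≈y∙xz r 3 (j * 3)) ⟩
  ceil3 (3 + (r + j * 3))  ≡⟨ ceil3-+3 (r + j * 3) ⟩
  suc (ceil3 (r + j * 3))  ≡⟨ cong suc (ceil3-+3j r j) ⟩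
  suc (ceil3 r + j)        ≡⟨ +-suc (ceil3 r) j ⟨
  ceil3 r + suc j          ∎
  where open ≡-Reasoning

residue-3j : ∀ j → residue (j * 3) ≡ r₀
residue-3j zero    = refl
residue-3j (suc j) = cong (next ∘ next ∘ next) (residue-3j j)

module ClosedForm (k : ℕ) (k≥2 : 2 ≤ k) where

  geometric : ℕ → ℕ
  geometric zero    = 0
  geometric (suc j) = 1 + k ^ 3 * geometric j

  kept-3j   : ∀ j → keptInSubtree k (j * 3) ≡ 1 + k ^ 2 * (k + 1) * geometric j
  kept-3j+1 : ∀ j → keptInSubtree k (1 + j * 3) ≡ (k + 1) * geometric (suc j)
  kept-3j+2 : ∀ j → keptInSubtree k (2 + j * 3) ≡ k * (k + 1) * geometric (suc j)

  kept-3j zero    = cong suc (sym (*-zeroʳ (k ^ 2 * (k + 1))))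
  kept-3j (suc j) = begin
    𝟙 (kept (next (next (next (residue (j * 3)))))) + k * keptInSubtree k (2 + j * 3)
      ≡⟨ cong₂ (λ q m → 𝟙 (kept (next (next (next q)))) + k * m) (residue-3j j) (kept-3j+2 j) ⟩
    1 + k * (k * (k + 1) * geometric (suc j))
      ≡⟨ cong suc (identity k (geometric (suc j))) ⟩
    1 + k ^ 2 * (k + 1) * geometric (suc j) ∎
    where
    open ≡-Reasoning
    identity : ∀ n g → n * (n * (n + 1) * g) ≡ n * (n * 1) * (n + 1) * g
    identity = solve-∀

  kept-3j+1 j = begin
    𝟙 (kept (next (residue (j * 3)))) + k * keptInSubtree k (j * 3)
      ≡⟨ cong₂ (λ q m → 𝟙 (kept (next q)) + k * m) (residue-3j j) (kept-3j j) ⟩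
    1 + k * (1 + k ^ 2 * (k + 1) * geometric j)
      ≡⟨ identity k (geometric j) ⟩
    (k + 1) * (1 + k ^ 3 * geometric j) ∎
    where
    open ≡-Reasoning
    identity : ∀ n g → 1 + n * (1 + n * (n * 1) * (n + 1) * g) ≡ (n + 1) * (1 + n * (n * (n * 1)) * g)
    identity = solve-∀

  kept-3j+2 j = begin
    𝟙 (kept (next (next (residue (j * 3))))) + k * keptInSubtree k (1 + j * 3)
      ≡⟨ cong₂ (λ q m → 𝟙 (kept (next (next q))) + k * m) (residue-3j j) (kept-3j+1 j) ⟩
    k * ((k + 1) * geometric (suc j))
      ≡⟨ *-assoc k (k + 1) _ ⟨
    k * (k + 1) * geometric (suc j) ∎
    where open ≡-Reasoning

  k³≥8 : 2 ^ 3 ≤ k ^ 3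
  k³≥8 = ^-monoˡ-≤ 3 k≥2

  pow-geometric : ∀ j → k ^ (3 * j) ≡ 1 + geometric j * (k ^ 3 ∸ 1)
  pow-geometric zero    = refl
  pow-geometric (suc j) = begin
    k ^ (3 * suc j)                          ≡⟨ cong (k ^_) (*-suc 3 j) ⟩
    k ^ (3 + 3 * j)                          ≡⟨ ^-distribˡ-+-* k 3 (3 * j) ⟩
    k ^ 3 * k ^ (3 * j)                      ≡⟨ cong₂ _*_ k³≡1+e (pow-geometric j) ⟩
    (1 + e) * (1 + geometric j * e)          ≡⟨ identity e (geometric j) ⟩
    1 + (1 + (1 + e) * geometric j) * e      ≡⟨ cong (λ m → 1 + (1 + m * geometric j) * e) k³≡1+e ⟨
    1 + geometric (suc j) * e                ∎
    where
    open ≡-Reasoning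
    e : ℕ
    e = k ^ 3 ∸ 1
    k³≡1+e : k ^ 3 ≡ 1 + e
    k³≡1+e = sym (m+[n∸m]≡n (≤-trans (s≤s z≤n) k³≥8))
    identity : ∀ e g → (1 + e) * (1 + g * e) ≡ 1 + (1 + (1 + e) * g) * e
    identity = solve-∀

  geometric-quotient : ∀ j → (k ^ (3 * j) ∸ 1) /' (k ^ 3 ∸ 1) ≡ geometric j
  geometric-quotient j = trans (cong (λ n → (n ∸ 1) /' (k ^ 3 ∸ 1)) (pow-geometric j))
                               (m*n/′n≡m (geometric j) (k ^ 3 ∸ 1) (≤-trans (s≤s z≤n) (∸-monoˡ-≤ 1 k³≥8)))

  closedForm : ℕ → ℕ → ℕ → ℕ
  closedForm m t g = (1 ∸ m) * (2 ∸ m) + k ^ t * (k + 1) * g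

  formula-at : ∀ d {m t c} → d % 3 ≡ m → (d ∸ 1) % 3 ≡ t → ceil3 d ≡ c →
               formula k d ≡ closedForm m t (geometric c)
  formula-at d refl refl refl =
    cong (λ g → (1 ∸ d % 3) * (2 ∸ d % 3) + k ^ ((d ∸ 1) % 3) * (k + 1) * g) (geometric-quotient (ceil3 d))

  redLD≡formula : ∀ d → redLD k d ≡ formula k d
  redLD≡formula d = subst (λ n → redLD k n ≡ formula k n) (sym (m≡m%n+[m/n]*n d 3))
                          (by-residue (d % 3) (d / 3) (m%n<n d 3))
    where
    open ≡-Reasoning
    by-residue : ∀ r j → r < 3 → redLD k (r + j * 3) ≡ formula k (r + j * 3)
    by-residue 0 zero    _ = sym (trans (formula-at 0 refl refl refl) (cong (2 +_) (*-zeroʳ (1 * (k + 1)))))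
    by-residue 0 (suc j) _ = begin
      keptInSubtree k (suc j * 3) + 𝟙 (isR₀ (residue (suc j * 3)))
        ≡⟨ cong₂ _+_ (kept-3j (suc j)) (cong (𝟙 ∘ isR₀) (residue-3j (suc j))) ⟩
      1 + k ^ 2 * (k + 1) * geometric (suc j) + 1
        ≡⟨ +-comm _ 1 ⟩
      closedForm 0 2 (geometric (suc j))
        ≡⟨ formula-at (suc j * 3) ([m+kn]%n≡m%n 0 (suc j) 3) ([m+kn]%n≡m%n 2 j 3) (ceil3-+3j 0 (suc j)) ⟨
      formula k (suc j * 3) ∎
    by-residue 1 j _ = begin
      keptInSubtree k (1 + j * 3) + 𝟙 (isR₀ (next (residue (j * 3))))
        ≡⟨ cong₂ _+_ (kept-3j+1 j) (cong (𝟙 ∘ isR₀ ∘ next) (residue-3j j)) ⟩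
      (k + 1) * geometric (suc j) + 0
        ≡⟨ trans (+-identityʳ _) (cong (_* geometric (suc j)) (sym (*-identityˡ (k + 1)))) ⟩
      closedForm 1 0 (geometric (suc j))
        ≡⟨ formula-at (1 + j * 3) ([m+kn]%n≡m%n 1 j 3) ([m+kn]%n≡m%n 0 j 3) (ceil3-+3j 1 j) ⟨
      formula k (1 + j * 3) ∎
    by-residue 2 j _ = begin
      keptInSubtree k (2 + j * 3) + 𝟙 (isR₀ (next (next (residue (j * 3)))))
        ≡⟨ cong₂ _+_ (kept-3j+2 j) (cong (𝟙 ∘ isR₀ ∘ next ∘ next) (residue-3j j)) ⟩
      k * (k + 1) * geometric (suc j) + 0
        ≡⟨ trans (+-identityʳ _) (cong (λ m → m * (k + 1) * geometric (suc j)) (sym (*-identityʳ k))) ⟩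
      closedForm 2 1 (geometric (suc j))
        ≡⟨ formula-at (2 + j * 3) ([m+kn]%n≡m%n 2 j 3) ([m+kn]%n≡m%n 1 j 3) (ceil3-+3j 2 j) ⟨
      formula k (2 + j * 3) ∎
    by-residue (suc (suc (suc _))) _ (s≤s (s≤s (s≤s ())))

redLD-1 : ∀ k → redLD k 1 ≡ k + 1
redLD-1 k = identity k
  where
  identity : ∀ n → 1 + n * 1 + 0 ≡ n + 1
  identity = solve-∀

redLD-2 : ∀ k → redLD k 2 ≡ k ^ 2 + k
redLD-2 k = identity k
  where
  identity : ∀ n → n * (1 + n * 1) + 0 ≡ n * (n * 1) + n
  identity = solve-∀

redLD-3 : ∀ k → redLD k 3 ≡ k ^ 3 + k ^ 2 + 2
redLD-3 k = identity k
  where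
  identity : ∀ n → 1 + n * (n * (1 + n * 1)) + 1 ≡ n * (n * (n * 1)) + n * (n * 1) + 2
  identity = solve-∀

theorem17 : (k d : ℕ) → 2 ≤ k → 1 ≤ d →
    (d ≡ 1 → RedLDTree k d (k + 1))
  × (d ≡ 2 → RedLDTree k d (k ^ 2 + k))
  × (d ≡ 3 → RedLDTree k d (k ^ 3 + k ^ 2 + 2))
  × (4 ≤ d → RedLDTree k d (formula k d))
theorem17 (suc zero) d (s≤s ()) d≥1
theorem17 k@(suc (suc k′)) d k≥2 d≥1 =
    (λ { refl → subst (RedLDTree k 1) (redLD-1 k) (redLD-tree k′ 1 d≥1) })
  , (λ { refl → subst (RedLDTree k 2) (redLD-2 k) (redLD-tree k′ 2 d≥1) })
  , (λ { refl → subst (RedLDTree k 3) (redLD-3 k) (redLD-tree k′ 3 d≥1) })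
  , (λ _ → subst (RedLDTree k d) (ClosedForm.redLD≡formula k k≥2 d) (redLD-tree k′ d d≥1))
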